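{- There is an online algorithm with advice for online unit clustering in $\mathbb{Z}$ which, on every request sequence consisting of $n$ points, reads at most $\lfloor n/2\rfloor$ bits of advice and clusters the sequence optimally (using the minimum possible number of clusters).
   Context: Online unit clustering in $\mathbb{Z}$: integer points arrive one by one; upon arrival each point must be irrevocably assigned to a cluster (an existing one or a newly opened one), and every cluster must have diameter at most $1$ (so a cluster contains at most two distinct consecutive integers). The cost is the number of clusters. Online algorithm with advice (tape model): an oracle knowing the whole input writes an infinite binary advice tape, which the algorithm may read sequentially; the number of advice bits used is the number of bits read. -}

module Defs where

open import Data.Nat using (ℕ; zero; suc; _≤_)
open import Data.Nat.Properties using () renaming (_≟_ to _≟ℕ_)
open import Data.Integer using (ℤ; _-_; ∣_∣)
open import Data.Bool using (Bool)
open import Data.List using (List; []; _∷_; _++_; [_]; length; zip; deduplicate)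
open import Data.List.Membership.Propositional using (_∈_)
open import Data.Product using (_×_; _,_)
open import Relation.Binary.PropositionalEquality using (_≡_)

-- An action of the online algorithm when processing the current request:
-- either read the next advice bit from the tape, or assign the current point
-- to the cluster with the given label (an existing label, or a fresh one,
-- which opens a new cluster).
data Action : Set where
  readBit : Action
  assign  : ℕ → Action

-- Its decision depends only on
-- the requests revealed so far (oldest first, the current one last) and on the
-- advice bits read so far (its own past decisions are determined by these).
Algorithm : Set
Algorithm = List ℤ → List Bool → Action

Tape : Set
Tape = ℕ → Bool

bits : Tape → ℕ → List Bool
bits t zero    = []
bits t (suc k) = bits t k ++ [ t k ]

-- Step A t xs k c k' : with requests xs revealed and k bits read so far, the
-- algorithm reads bits until it has read k' bits in total and then assigns the
-- current point to cluster c.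
data Step (A : Algorithm) (t : Tape) (xs : List ℤ) : ℕ → ℕ → ℕ → Set where
  done : ∀ {k c} → A xs (bits t k) ≡ assign c → Step A t xs k c k
  more : ∀ {k c k'} → A xs (bits t k) ≡ readBit →
         Step A t xs (suc k) c k' → Step A t xs k c k'

-- Run A t xs cs k : processing the request sequence xs, the algorithm produces
-- cluster labels cs (one per request, in order) and reads k advice bits in total.
data Run (A : Algorithm) (t : Tape) : List ℤ → List ℕ → ℕ → Set where
  start : Run A t [] [] 0
  next  : ∀ {xs cs k x c k'} → Run A t xs cs k →
          Step A t (xs ++ [ x ]) k c k' →
          Run A t (xs ++ [ x ]) (cs ++ [ c ]) k'

ValidClustering : List ℤ → List ℕ → Set
ValidClustering xs cs =
  ∀ x y c → (x , c) ∈ zip xs cs → (y , c) ∈ zip xs cs → ∣ x - y ∣ ≤ 1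

cost : List ℕ → ℕ
cost cs = length (deduplicate _≟ℕ_ cs)

Optimal : List ℤ → List ℕ → Set
Optimal xs cs = ValidClustering xs cs ×
  (∀ ds → length ds ≡ length xs → ValidClustering xs ds → cost cs ≤ cost ds)

{-# OPTIONS --safe #-}
-- Pair every maximal run of consecutive requested points greedily from its left end: a point
-- leads (opens a pair with its successor) iff an even number of consecutive requested points lie
-- just below it.  This clustering is optimal, because its clusters correspond to the leaders and
-- no two leaders are adjacent, so any valid clustering separates all of them.
--
-- The algorithm reproduces it online.  A repeated point keeps its label; a new point x joins the
-- cluster of its mate (x + 1 if x leads, x - 1 otherwise), or a fresh one if the mate is unseen.
-- Whether x leads is read off two consecutive labelled points on either side of x (they share a
-- label iff the lower one leads).  Only if that fails while some neighbour y of x is labelled is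
-- an advice bit read; then y was isolated (no requested neighbours) and neither x nor y is
-- isolated afterwards, so 2 * (bits read) + (isolated requests) never exceeds the number of
-- requests, which bounds the advice by n / 2.
module Submission where

open import Defs
open import Level using (0ℓ)
open import Function using (_∘_; _⇔_; mk⇔; Equivalence)
open import Data.Bool using (Bool; _≟_; true; false; not; _∨_; if_then_else_)
open import Data.Bool.Properties using (not-involutive)
open import Data.Nat using (ℕ; zero; suc; _≤_; _<_; _/_; _+_; _*_; z≤n; s≤s)
open import Data.Nat.Properties
  using (≤-refl; ≤-reflexive; ≤-trans; <-irrefl; <⇒≤; suc-injective; m≤m+n; *-comm; 1+n≰n; m≤n⇒m≤1+n;
         +-monoˡ-≤; +-monoʳ-≤; +-mono-≤; +-assoc; +-comm; +-identityʳ; module ≤-Reasoning)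
  renaming (_≟_ to _≟ℕ_)
import Data.Nat.DivMod as ℕ
open import Data.Integer using (ℤ; ∣_∣; _-_; +_; -[1+_]) renaming (suc to sucℤ; pred to predℤ)
import Data.Integer as ℤ
import Data.Integer.Properties as ℤₚ
open import Data.Integer.Tactic.RingSolver using (solve-∀)
import Data.Nat.Tactic.RingSolver as ℕ-Solver
open import Data.Maybe using (Maybe; just; nothing; fromMaybe; is-just; _<∣>_)
import Data.Maybe as Maybe
open import Data.List using (List; []; _∷_; _++_; [_]; length; map; filter; foldl; deduplicate; zip)
open import Data.List.Properties
  using (length-++; length-++-sucʳ; length-map; map-++; ++-assoc; ++-identityʳ; filter-++; filter-reject;
         length-filter; foldl-∷ʳ)
open import Data.List.Membership.Propositional using (_∈_; _∉_)
open import Data.List.Membership.Propositional.Properties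
  using (∈-∃++; ∈-++⁺ˡ; ∈-++⁺ʳ; ∈-++⁻; ∈-map⁺; ∈-map⁻; ∈-filter⁺; ∈-filter⁻;
         ∈-deduplicate⁺; ∈-deduplicate⁻)
open import Data.List.Membership.DecPropositional ℤₚ._≟_ using (_∈?_)
open import Data.List.Relation.Binary.Subset.Propositional using (_⊆_)
open import Data.List.Relation.Unary.Any using (here; there)
open import Data.List.Reverse using (Reverse; []; _∶_∶ʳ_; reverseView)
open import Data.List.Relation.Unary.All as All using (All; []; _∷_)
import Data.List.Relation.Unary.All.Properties as All
open import Data.List.Relation.Unary.AllPairs using ([]; _∷_)
open import Data.List.Relation.Unary.Unique.Propositional using (Unique)
open import Data.List.Relation.Unary.Unique.DecPropositional.Properties using (deduplicate-!)
open import Data.Product using (Σ; ∃-syntax; _×_; _,_; proj₁; proj₂)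
open import Data.Sum using (_⊎_; inj₁; inj₂; swap)
open import Relation.Nullary using (¬_; yes; no; does; contradiction; ¬?; _×-dec_)
open import Relation.Nullary.Decidable using (dec-true; dec-false; does-⇔)
open import Relation.Unary using (Pred; Decidable)
open import Relation.Binary.PropositionalEquality
  using (_≡_; _≢_; refl; sym; trans; cong; cong₂; subst; subst₂; module ≡-Reasoning)

module _ {A : Set} where

  length-≤-⊆ : {xs ys : List A} → Unique xs → xs ⊆ ys → length xs ≤ length ys
  length-≤-⊆ {[]}     _              _     = z≤n
  length-≤-⊆ {x ∷ xs} (x∉xs ∷ xs!) xs⊆ys with ∈-∃++ (xs⊆ys (here refl))
  ... | ys₁ , ys₂ , refl = begin
    suc (length xs)               ≤⟨ s≤s (length-≤-⊆ xs! xs⊆ys₁++ys₂) ⟩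
    suc (length (ys₁ ++ ys₂))     ≡⟨ length-++-sucʳ ys₁ x ys₂ ⟨
    length (ys₁ ++ [ x ] ++ ys₂)  ∎
    where
    open ≤-Reasoning
    xs⊆ys₁++ys₂ : xs ⊆ ys₁ ++ ys₂
    xs⊆ys₁++ys₂ y∈xs with ∈-++⁻ ys₁ (xs⊆ys (there y∈xs))
    ... | inj₁ y∈ys₁          = ∈-++⁺ˡ y∈ys₁
    ... | inj₂ (here refl)    = contradiction refl (All.lookup x∉xs y∈xs)
    ... | inj₂ (there y∈ys₂)  = ∈-++⁺ʳ ys₁ y∈ys₂

  map⁺-injectiveOn : {B : Set} {f : A → B} {xs : List A} →
                     (∀ {x y} → x ∈ xs → y ∈ xs → f x ≡ f y → x ≡ y) →
                     Unique xs → Unique (map f xs)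
  map⁺-injectiveOn {xs = []}     _   []           = []
  map⁺-injectiveOn {xs = x ∷ xs} inj (x∉xs ∷ xs!) =
    All.map⁺ (All.tabulate λ y∈xs fx≡fy → All.lookup x∉xs y∈xs (inj (here refl) (there y∈xs) fx≡fy))
    ∷ map⁺-injectiveOn (λ x∈ y∈ → inj (there x∈) (there y∈)) xs!

  count : {P : Pred A 0ℓ} → Decidable P → List A → ℕ
  count P? = length ∘ filter P?

  count-++ : {P : Pred A 0ℓ} (P? : Decidable P) →
             ∀ xs ys → count P? (xs ++ ys) ≡ count P? xs + count P? ys
  count-++ P? xs ys = trans (cong length (filter-++ P? xs ys)) (length-++ (filter P? xs))

  module _ {P Q : Pred A 0ℓ} (P? : Decidable P) (Q? : Decidable Q) (P⇒Q : ∀ a → P a → Q a) where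

    count-mono : ∀ xs → count P? xs ≤ count Q? xs
    count-mono []       = z≤n
    count-mono (a ∷ xs) with P? a | Q? a
    ... | yes _ | yes _  = s≤s (count-mono xs)
    ... | yes p | no ¬q  = contradiction (P⇒Q a p) ¬q
    ... | no _  | yes _  = m≤n⇒m≤1+n (count-mono xs)
    ... | no _  | no _   = count-mono xs

    count-mono-< : ∀ {y xs} → y ∈ xs → ¬ P y → Q y → count P? xs < count Q? xs
    count-mono-< {y} {a ∷ xs} y∈ ¬py qy with P? a | Q? a | y∈
    ... | yes p | no ¬q | _          = contradiction (P⇒Q a p) ¬q
    ... | yes p | yes _ | here refl  = contradiction p ¬py
    ... | yes _ | yes _ | there y∈xs = s≤s (count-mono-< y∈xs ¬py qy)
    ... | no _  | yes _ | _          = s≤s (count-mono xs)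
    ... | no _  | no ¬q | here refl  = contradiction qy ¬q
    ... | no _  | no _  | there y∈xs = count-mono-< y∈xs ¬py qy

  ∈⇒length≡suc : {x : A} {xs : List A} → x ∈ xs → ∃[ n ] length xs ≡ suc n
  ∈⇒length≡suc {xs = _ ∷ xs} _ = length xs , refl

  ∈-∷ʳ⁻ : {x y : A} {xs : List A} → x ∈ xs ++ [ y ] → x ∈ xs ⊎ x ≡ y
  ∈-∷ʳ⁻ {xs = xs} x∈ with ∈-++⁻ xs x∈
  ... | inj₁ x∈xs      = inj₁ x∈xs
  ... | inj₂ (here x≡y) = inj₂ x≡y

  zip-proj₁-proj₂ : ∀ {B : Set} (ps : List (A × B)) → zip (map proj₁ ps) (map proj₂ ps) ≡ ps
  zip-proj₁-proj₂ []       = refl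
  zip-proj₁-proj₂ (p ∷ ps) = cong (p ∷_) (zip-proj₁-proj₂ ps)

  ∈-zip⁺ : ∀ {B : Set} {x : A} {xs : List A} {ys : List B} →
           length ys ≡ length xs → x ∈ xs → ∃[ y ] (x , y) ∈ zip xs ys
  ∈-zip⁺ {ys = y ∷ ys} _     (here refl) = y , here refl
  ∈-zip⁺ {ys = y ∷ ys} |ys|≡ (there x∈)  with ∈-zip⁺ (suc-injective |ys|≡) x∈
  ... | y′ , xy′∈ = y′ , there xy′∈

  ∈-zip⁻ʳ : ∀ {B : Set} {x : A} {y : B} xs ys → (x , y) ∈ zip xs ys → y ∈ ys
  ∈-zip⁻ʳ (_ ∷ xs) (_ ∷ ys) (here refl) = here refl
  ∈-zip⁻ʳ (_ ∷ xs) (_ ∷ ys) (there xy∈) = there (∈-zip⁻ʳ xs ys xy∈)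

≡⇔≡-sym : {A B : Set} {a a′ : A} {b b′ : B} → (a ≡ a′) ⇔ (b ≡ b′) → (a′ ≡ a) ⇔ (b′ ≡ b)
≡⇔≡-sym a⇔b = mk⇔ (sym ∘ Equivalence.to a⇔b ∘ sym) (sym ∘ Equivalence.from a⇔b ∘ sym)

cost-≤ : {A : Set} (f : A → ℕ) (rs : List A) {cs : List ℕ} →
         (∀ {c} → c ∈ cs → c ∈ map f rs) → cost cs ≤ length rs
cost-≤ f rs {cs} cs⊆f[rs] = begin
  cost cs            ≤⟨ length-≤-⊆ (deduplicate-! _≟ℕ_ cs) (cs⊆f[rs] ∘ ∈-deduplicate⁻ _≟ℕ_ cs) ⟩
  length (map f rs)  ≡⟨ length-map f rs ⟩
  length rs          ∎
  where open ≤-Reasoning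

≤-cost : {A : Set} (f : A → ℕ) {rs : List A} {cs : List ℕ} → Unique rs →
         (∀ {r r′} → r ∈ rs → r′ ∈ rs → f r ≡ f r′ → r ≡ r′) →
         (∀ {r} → r ∈ rs → f r ∈ cs) → length rs ≤ cost cs
≤-cost f {rs} {cs} rs! f-inj f[rs]⊆cs = begin
  length rs          ≡⟨ length-map f rs ⟨
  length (map f rs)  ≤⟨ length-≤-⊆ (map⁺-injectiveOn f-inj rs!) f[rs]⊆dedup ⟩
  cost cs            ∎
  where
  open ≤-Reasoning
  f[rs]⊆dedup : map f rs ⊆ deduplicate _≟ℕ_ cs
  f[rs]⊆dedup c∈ with r , r∈rs , refl ← ∈-map⁻ f c∈ = ∈-deduplicate⁺ _≟ℕ_ (f[rs]⊆cs r∈rs)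

k≤n/2 : ∀ {k n} → 2 * k ≤ n → k ≤ n / 2
k≤n/2 {k} {n} 2k≤n = begin
  k          ≡⟨ ℕ.m*n/n≡m k 2 ⟨
  k * 2 / 2  ≤⟨ ℕ./-monoˡ-≤ 2 (≤-trans (≤-reflexive (*-comm k 2)) 2k≤n) ⟩
  n / 2      ∎
  where open ≤-Reasoning

Neighbours : ℤ → ℤ → Set
Neighbours x y = y ≡ sucℤ x ⊎ x ≡ sucℤ y

i≡[i-j]+j : ∀ i j → i ≡ (i - j) ℤ.+ j
i≡[i-j]+j = solve-∀

∣i-j∣≤1⇒≡∨neighbours : ∀ i j → ∣ i - j ∣ ≤ 1 → i ≡ j ⊎ Neighbours j i
∣i-j∣≤1⇒≡∨neighbours i j ∣i-j∣≤1 with i - j | i≡[i-j]+j i j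
∣i-j∣≤1⇒≡∨neighbours i j _       | + 0            | i≡0+j  = inj₁ (trans i≡0+j (ℤₚ.+-identityˡ j))
∣i-j∣≤1⇒≡∨neighbours i j _       | + 1            | i≡1+j  = inj₂ (inj₁ i≡1+j)
∣i-j∣≤1⇒≡∨neighbours i j _       | -[1+ 0 ]       | i≡-1+j =
  inj₂ (inj₂ (trans (sym (ℤₚ.suc-pred j)) (cong sucℤ (sym i≡-1+j))))
∣i-j∣≤1⇒≡∨neighbours i j (s≤s ()) | + suc (suc _) | _
∣i-j∣≤1⇒≡∨neighbours i j (s≤s ()) | -[1+ suc _ ]  | _

predℤ-injective : ∀ {i j} → predℤ i ≡ predℤ j → i ≡ j
predℤ-injective {i} {j} pi≡pj = trans (sym (ℤₚ.suc-pred i)) (trans (cong sucℤ pi≡pj) (ℤₚ.suc-pred j))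

predℤ≢sucℤ : ∀ i → predℤ i ≢ sucℤ i
predℤ≢sucℤ i = ℤₚ.<⇒≢ (ℤₚ.<-trans (ℤₚ.i≤pred[j]⇒i<j {j = i} ℤₚ.≤-refl) (ℤₚ.suc[i]≤j⇒i<j {i} ℤₚ.≤-refl))

partner : Bool → ℤ → ℤ
partner true  = sucℤ
partner false = predℤ

∣partner-i∣≡1 : ∀ b i → ∣ partner b i - i ∣ ≡ 1
∣partner-i∣≡1 true  i = cong ∣_∣ ([1+i]-i≡1 i)
  where [1+i]-i≡1 : ∀ i → (+ 1 ℤ.+ i) - i ≡ + 1
        [1+i]-i≡1 = solve-∀
∣partner-i∣≡1 false i = cong ∣_∣ ([-1+i]-i≡-1 i)
  where [-1+i]-i≡-1 : ∀ i → (-[1+ 0 ] ℤ.+ i) - i ≡ -[1+ 0 ]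
        [-1+i]-i≡-1 = solve-∀

∣i-i∣≡0 : ∀ i → ∣ i - i ∣ ≡ 0
∣i-i∣≡0 i = cong ∣_∣ (ℤₚ.+-inverseʳ i)

descending : ℕ → ℤ → List ℤ
descending zero    z = [ z ]
descending (suc m) z = z ∷ descending m (predℤ z)

length-descending : ∀ m z → length (descending m z) ≡ suc m
length-descending zero    z = refl
length-descending (suc m) z = cong suc (length-descending m (predℤ z))

descending-≤ : ∀ m z → All (ℤ._≤ z) (descending m z)
descending-≤ zero    z = ℤₚ.≤-refl ∷ []
descending-≤ (suc m) z =
  ℤₚ.≤-refl ∷ All.map (λ w≤pz → ℤₚ.≤-trans w≤pz (ℤₚ.i≤j⇒pred[i]≤j ℤₚ.≤-refl)) (descending-≤ m (predℤ z))

descending-unique : ∀ m z → Unique (descending m z)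
descending-unique zero    z = [] ∷ []
descending-unique (suc m) z =
  All.map (λ w≤pz z≡w → ℤₚ.<⇒≢ (ℤₚ.i≤pred[j]⇒i<j w≤pz) (sym z≡w)) (descending-≤ m (predℤ z))
  ∷ descending-unique m (predℤ z)

-- The canonical optimal clustering

module CanonicalPairing (S : List ℤ) where

  -- Fuel length S suffices, as no run of S is longer (run-length≤).
  leadsWithin : ℕ → ℤ → Bool
  leadsWithin zero    x = true
  leadsWithin (suc n) x = if does (predℤ x ∈? S) then not (leadsWithin n (predℤ x)) else true

  leads : ℤ → Bool
  leads = leadsWithin (length S)

  leader : ℤ → ℤ
  leader x = if leads x then x else predℤ x

  mate : ℤ → ℤ
  mate x = partner (leads x) x

  run-length≤ : ∀ {m z} → All (_∈ S) (descending m z) → suc m ≤ length S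
  run-length≤ {m} {z} run =
    subst (_≤ length S) (length-descending m z) (length-≤-⊆ (descending-unique m z) (All.lookup run))

  leadsWithin-suc : ∀ n {x} → predℤ x ∈ S → leadsWithin (suc n) x ≡ not (leadsWithin n (predℤ x))
  leadsWithin-suc n {x} px∈S rewrite dec-true (predℤ x ∈? S) px∈S = refl

  leadsWithin-stable : ∀ n x → ¬ All (_∈ S) (descending n (predℤ x)) →
                       leadsWithin n x ≡ leadsWithin (suc n) x
  leadsWithin-stable zero    x ¬run with predℤ x ∈? S
  ... | yes px∈S = contradiction (px∈S ∷ []) ¬run
  ... | no  _    = refl
  leadsWithin-stable (suc n) x ¬run with predℤ x ∈? S
  ... | yes px∈S = cong not (leadsWithin-stable n (predℤ x) (¬run ∘ (px∈S ∷_)))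
  ... | no  _    = refl

  leads-start : ∀ {x} → predℤ x ∉ S → leads x ≡ true
  leads-start {x} px∉S with length S
  ... | zero  = refl
  ... | suc n rewrite dec-false (predℤ x ∈? S) px∉S = refl

  leads-step : ∀ {x} → x ∈ S → predℤ x ∈ S → leads x ≡ not (leads (predℤ x))
  leads-step {x} x∈S px∈S with ∈⇒length≡suc x∈S
  ... | n , |S|≡1+n = begin
    leads x                                 ≡⟨ cong (λ k → leadsWithin k x) |S|≡1+n ⟩
    leadsWithin (suc n) x                   ≡⟨ leadsWithin-suc n {x} px∈S ⟩
    not (leadsWithin n (predℤ x))           ≡⟨ cong not (leadsWithin-stable n (predℤ x) ¬run) ⟩
    not (leadsWithin (suc n) (predℤ x))     ≡⟨ cong (λ k → not (leadsWithin k (predℤ x))) |S|≡1+n ⟨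
    not (leads (predℤ x))                   ∎
    where
    open ≡-Reasoning
    ¬run : ¬ All (_∈ S) (descending n (predℤ (predℤ x)))
    ¬run run = 1+n≰n (≤-trans (run-length≤ (px∈S ∷ run)) (≤-reflexive |S|≡1+n))

  leads-suc : ∀ {x} → x ∈ S → sucℤ x ∈ S → leads (sucℤ x) ≡ not (leads x)
  leads-suc {x} x∈S sx∈S =
    trans (leads-step sx∈S (subst (_∈ S) (sym (ℤₚ.pred-suc x)) x∈S)) (cong (not ∘ leads) (ℤₚ.pred-suc x))

  leads-pred : ∀ {x} → x ∈ S → leads x ≡ false → predℤ x ∈ S × leads (predℤ x) ≡ true
  leads-pred {x} x∈S ¬lx with predℤ x ∈? S
  ... | no  px∉S = contradiction (trans (sym (leads-start px∉S)) ¬lx) λ ()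
  ... | yes px∈S with leads (predℤ x) | leads-step x∈S px∈S
  ...   | true  | _    = px∈S , refl
  ...   | false | lx≡t = contradiction (trans (sym lx≡t) ¬lx) λ ()

  leader∈S : ∀ {x} → x ∈ S → leader x ∈ S
  leader∈S {x} x∈S with leads x in lx
  ... | true  = x∈S
  ... | false = proj₁ (leads-pred x∈S lx)

  leads-leader : ∀ {x} → x ∈ S → leads (leader x) ≡ true
  leads-leader {x} x∈S with leads x in lx
  ... | true  = lx
  ... | false = proj₂ (leads-pred x∈S lx)

  leader-mate : ∀ {x} → x ∈ S → mate x ∈ S → leader (mate x) ≡ leader x
  leader-mate {x} x∈S mx∈S with leads x in lx
  ... | false rewrite proj₂ (leads-pred x∈S lx) = refl
  ... | true  rewrite leads-suc x∈S mx∈S | lx = ℤₚ.pred-suc x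

  leader≡⇒≡∨mate : ∀ {p x} → leader p ≡ leader x → p ≡ x ⊎ p ≡ mate x
  leader≡⇒≡∨mate {p} {x} lp≡lx with leads p | leads x
  ... | true  | true  = inj₁ lp≡lx
  ... | true  | false = inj₂ lp≡lx
  ... | false | true  = inj₂ (trans (sym (ℤₚ.suc-pred p)) (cong sucℤ lp≡lx))
  ... | false | false = inj₁ (predℤ-injective lp≡lx)

  leader≡⇒∣i-j∣≤1 : ∀ {p x} → leader p ≡ leader x → ∣ p - x ∣ ≤ 1
  leader≡⇒∣i-j∣≤1 {x = x} lp≡lx with leader≡⇒≡∨mate lp≡lx
  ... | inj₁ refl = ≤-trans (≤-reflexive (∣i-i∣≡0 x)) z≤n
  ... | inj₂ refl = ≤-reflexive (∣partner-i∣≡1 (leads x) x)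

  leader-leader : ∀ {x} → x ∈ S → leader (leader x) ≡ leader x
  leader-leader {x} x∈S = cong (λ b → if b then leader x else predℤ (leader x)) (leads-leader x∈S)

  leaders-not-adjacent : ∀ {r} → r ∈ S → sucℤ r ∈ S → leads r ≡ true → leads (sucℤ r) ≢ true
  leaders-not-adjacent r∈S sr∈S lr lsr =
    contradiction (trans (sym lsr) (trans (leads-suc r∈S sr∈S) (cong not lr))) λ ()

  does-leader≟leader-suc : ∀ {y} → y ∈ S → sucℤ y ∈ S → does (leader y ℤₚ.≟ leader (sucℤ y)) ≡ leads y
  does-leader≟leader-suc {y} y∈S sy∈S with leads y in ly
  ... | true  rewrite leads-suc y∈S sy∈S | ly = dec-true (y ℤₚ.≟ predℤ (sucℤ y)) (sym (ℤₚ.pred-suc y))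
  ... | false rewrite leads-suc y∈S sy∈S | ly = dec-false (predℤ y ℤₚ.≟ sucℤ y) (predℤ≢sucℤ y)

-- Algorithms that replay their own past decisions

Labelling : Set
Labelling = List (ℤ × ℕ)

points : Labelling → List ℤ
points = map proj₁

points-∷ʳ-++ : ∀ st y ys → points (st ++ [ y ]) ++ ys ≡ points st ++ proj₁ y ∷ ys
points-∷ʳ-++ st y ys = trans (cong (_++ ys) (map-++ proj₁ st [ y ])) (++-assoc (points st) [ proj₁ y ] ys)

lookupLabel : ℤ → Labelling → Maybe ℕ
lookupLabel x []             = nothing
lookupLabel x ((p , c) ∷ st) = if does (x ℤₚ.≟ p) then just c else lookupLabel x st

lookupLabel-just : ∀ {x c} st → lookupLabel x st ≡ just c → (x , c) ∈ st
lookupLabel-just {x} ((p , _) ∷ st) eq with x ℤₚ.≟ p | eq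
... | yes refl | refl = here refl
... | no  _    | eq′  = there (lookupLabel-just st eq′)

lookupLabel-nothing : ∀ {x} st → lookupLabel x st ≡ nothing → x ∉ points st
lookupLabel-nothing {x} ((p , _) ∷ st) eq x∈ with x ℤₚ.≟ p | eq | x∈
... | yes _   | ()  | _
... | no  x≢p | _   | here x≡p   = x≢p x≡p
... | no  _   | eq′ | there x∈′  = lookupLabel-nothing st eq′ x∈′

lookupLabel-complete : ∀ {x c} st → (x , c) ∈ st → ∃[ c′ ] lookupLabel x st ≡ just c′
lookupLabel-complete {x} st x∈ with lookupLabel x st in eq
... | just c′ = c′ , refl
... | nothing = contradiction (∈-map⁺ proj₁ x∈) (lookupLabel-nothing st eq)

labelIn : Labelling → ℤ → ℕ
labelIn st x = fromMaybe 0 (lookupLabel x st)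

labelIn-∈ : ∀ {x c} {st} → (x , c) ∈ st → (x , labelIn st x) ∈ st
labelIn-∈ {x} {st = st} x∈ with lookupLabel-complete st x∈
... | c′ , found rewrite found = lookupLabel-just st found

data Decision : Set where
  label : ℕ → Decision
  ask   : (Bool → ℕ) → Decision

chosen : Decision → Bool → ℕ
chosen (label c) _ = c
chosen (ask f)   b = f b

spent : Decision → Bool → List Bool
spent (label _) _ = []
spent (ask _)   b = [ b ]

act : Decision → List Bool → Action
act (label c) _       = assign c
act (ask f)   []      = readBit
act (ask f)   (b ∷ _) = assign (f b)

consume : Decision → List Bool → ℕ × List Bool
consume (label c) bs       = c , bs
consume (ask f)   []       = f false , []
consume (ask f)   (b ∷ bs) = f b , bs

consume-spent : ∀ d b bs → consume d (spent d b ++ bs) ≡ (chosen d b , bs)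
consume-spent (label _) _ _ = refl
consume-spent (ask _)   _ _ = refl

tapeOf : List Bool → Tape
tapeOf []       _       = false
tapeOf (b ∷ _)  zero    = b
tapeOf (_ ∷ bs) (suc i) = tapeOf bs i

tapeOf-length : ∀ P b R → tapeOf (P ++ b ∷ R) (length P) ≡ b
tapeOf-length []      b R = refl
tapeOf-length (_ ∷ P) b R = tapeOf-length P b R

bits-suc : ∀ t k → bits t (suc k) ≡ t 0 ∷ bits (t ∘ suc) k
bits-suc t zero    = refl
bits-suc t (suc k) = cong (_++ [ t (suc k) ]) (bits-suc t k)

bits-tapeOf : ∀ P R → bits (tapeOf (P ++ R)) (length P) ≡ P
bits-tapeOf []      R = refl
bits-tapeOf (b ∷ P) R = trans (bits-suc (tapeOf (b ∷ P ++ R)) (length P)) (cong (b ∷_) (bits-tapeOf P R))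

-- The bit count is written so that it computes to length P or suc (length P).
act-Step : ∀ {A : Algorithm} {xs} d b P R → (∀ rest → A xs (P ++ rest) ≡ act d rest) →
           Step A (tapeOf (P ++ spent d b ++ R)) xs (length P) (chosen d b) (length (spent d b) + length P)
act-Step {A} {xs} (label c) b P R A≡act =
  done (trans (cong (A xs) (trans (bits-tapeOf P R) (sym (++-identityʳ P)))) (A≡act []))
act-Step {A} {xs} (ask f) b P R A≡act =
  more (trans (cong (A xs) (trans (bits-tapeOf P (b ∷ R)) (sym (++-identityʳ P)))) (A≡act []))
       (done (trans (cong (A xs) bits≡P++b) (A≡act [ b ])))
  where
  bits≡P++b : bits (tapeOf (P ++ b ∷ R)) (suc (length P)) ≡ P ++ [ b ]
  bits≡P++b = cong₂ _++_ (bits-tapeOf P (b ∷ R)) (cong [_] (tapeOf-length P b R))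

module Replay (decide : Labelling → ℤ → Decision) where

  -- The algorithm keeps no state: it replays the earlier requests, consuming the bits read so far,
  -- to recover its own earlier labels.
  respondFrom : Labelling → List Bool → ℤ → List ℤ → Action
  respondFrom st bs x []       = act (decide st x) bs
  respondFrom st bs x (y ∷ ys) = respondFrom (st ++ [ (x , proj₁ r) ]) (proj₂ r) y ys
    where r = consume (decide st x) bs

  algorithm : Algorithm
  algorithm []       _  = readBit   -- never consulted: every Step has a current request
  algorithm (x ∷ xs) bs = respondFrom [] bs x xs

  module WithOracle (oracle : ℤ → Bool) where

    extend : Labelling → ℤ → Labelling
    extend st x = st ++ [ (x , chosen (decide st x) (oracle x)) ]

    labelling : Labelling → List ℤ → Labelling
    labelling = foldl extend

    advice : Labelling → List ℤ → List Bool
    advice st []       = []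
    advice st (x ∷ xs) = spent (decide st x) (oracle x) ++ advice (extend st x) xs

    advice-++ : ∀ st h s → advice st (h ++ s) ≡ advice st h ++ advice (labelling st h) s
    advice-++ st []      s = refl
    advice-++ st (x ∷ h) s =
      trans (cong (spent (decide st x) (oracle x) ++_) (advice-++ (extend st x) h s))
            (sym (++-assoc (spent (decide st x) (oracle x)) (advice (extend st x) h) _))

    respondFrom-spent : ∀ st y bs z zs →
      respondFrom st (spent (decide st y) (oracle y) ++ bs) y (z ∷ zs) ≡ respondFrom (extend st y) bs z zs
    respondFrom-spent st y bs z zs rewrite consume-spent (decide st y) (oracle y) bs = refl

    respondFrom-advice : ∀ st y h x rest →
      respondFrom st (advice st (y ∷ h) ++ rest) y (h ++ [ x ]) ≡ act (decide (labelling st (y ∷ h)) x) rest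
    respondFrom-advice st y h x rest = trans
      (cong (λ bs → respondFrom st bs y (h ++ [ x ]))
            (++-assoc (spent (decide st y) (oracle y)) (advice (extend st y) h) rest))
      (continue h)
      where
      continue : ∀ h →
        respondFrom st (spent (decide st y) (oracle y) ++ advice (extend st y) h ++ rest) y (h ++ [ x ])
        ≡ act (decide (labelling st (y ∷ h)) x) rest
      continue []      = respondFrom-spent st y rest x []
      continue (z ∷ h) =
        trans (respondFrom-spent st y _ z (h ++ [ x ])) (respondFrom-advice (extend st y) z h x rest)

    algorithm-advice : ∀ h x rest →
      algorithm (h ++ [ x ]) (advice [] h ++ rest) ≡ act (decide (labelling [] h) x) rest
    algorithm-advice []      x rest = refl
    algorithm-advice (y ∷ h) x rest = respondFrom-advice [] y h x rest

    labelling-∷ʳ : ∀ h x → labelling [] (h ++ [ x ]) ≡ extend (labelling [] h) x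
    labelling-∷ʳ h x = foldl-∷ʳ extend [] x h

    points-labelling : ∀ st ys → points (labelling st ys) ≡ points st ++ ys
    points-labelling st []       = sym (++-identityʳ (points st))
    points-labelling st (y ∷ ys) = trans (points-labelling (extend st y) ys) (points-∷ʳ-++ st _ ys)

    labelling-preserves : (P : Labelling → Set) → ∀ {st} ys →
      (∀ {st x} → x ∈ ys → P st → P (extend st x)) → P st → P (labelling st ys)
    labelling-preserves P []       _    Pst = Pst
    labelling-preserves P (y ∷ ys) pres Pst =
      labelling-preserves P ys (pres ∘ there) (pres (here refl) Pst)

    advice-potential : (Φ : List ℤ → ℕ) →
      (∀ st x → 2 * length (spent (decide st x) (oracle x)) + Φ (points st ++ [ x ]) ≤ Φ (points st) + 1) →
      ∀ st ys → 2 * length (advice st ys) + Φ (points st ++ ys) ≤ Φ (points st) + length ys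
    advice-potential Φ local st [] =
      ≤-reflexive (trans (cong Φ (++-identityʳ (points st))) (sym (+-identityʳ (Φ (points st)))))
    advice-potential Φ local st (y ∷ ys) = begin
      2 * length (spent d (oracle y) ++ adv) + Φ (points st ++ y ∷ ys)
        ≡⟨ cong₂ (λ n h → 2 * n + Φ h) (length-++ (spent d (oracle y))) (sym (points-∷ʳ-++ st _ ys)) ⟩
      2 * (s + a) + Φ (points st′ ++ ys)
        ≡⟨ regroup s a (Φ (points st′ ++ ys)) ⟩
      2 * s + (2 * a + Φ (points st′ ++ ys))
        ≤⟨ +-monoʳ-≤ (2 * s) (advice-potential Φ local st′ ys) ⟩
      2 * s + (Φ (points st′) + length ys)
        ≡⟨ cong (λ h → 2 * s + (Φ h + length ys)) (map-++ proj₁ st _) ⟩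
      2 * s + (Φ (points st ++ [ y ]) + length ys)
        ≡⟨ +-assoc (2 * s) _ (length ys) ⟨
      2 * s + Φ (points st ++ [ y ]) + length ys
        ≤⟨ +-monoˡ-≤ (length ys) (local st y) ⟩
      Φ (points st) + 1 + length ys
        ≡⟨ +-assoc (Φ (points st)) 1 (length ys) ⟩
      Φ (points st) + length (y ∷ ys) ∎
      where
      open ≤-Reasoning
      d = decide st y
      st′ = extend st y
      adv = advice st′ ys
      s = length (spent d (oracle y))
      a = length adv
      regroup : ∀ s a f → 2 * (s + a) + f ≡ 2 * s + (2 * a + f)
      regroup = ℕ-Solver.solve-∀

    labels : List ℤ → List ℕ
    labels h = map proj₂ (labelling [] h)

    module _ (xs : List ℤ) where

      tape : Tape
      tape = tapeOf (advice [] xs)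

      run-prefix : ∀ {h} → Reverse h → ∀ s → h ++ s ≡ xs →
                   Run algorithm tape h (labels h) (length (advice [] h))
      run-prefix []             _ _        = start
      run-prefix (h ∶ rh ∶ʳ x) s h∷ʳx++s≡xs =
        subst₂ (Run algorithm tape (h ++ [ x ])) (sym labels-∷ʳ) (sym length-advice-∷ʳ)
               (next (run-prefix rh (x ∷ s) h++x∷s≡xs) step)
        where
        h++x∷s≡xs : h ++ x ∷ s ≡ xs
        h++x∷s≡xs = trans (sym (++-assoc h [ x ] s)) h∷ʳx++s≡xs
        d = decide (labelling [] h) x
        b = oracle x
        tape≡ : tapeOf (advice [] h ++ spent d b ++ advice (extend (labelling [] h) x) s) ≡ tape
        tape≡ = cong tapeOf (trans (sym (advice-++ [] h (x ∷ s))) (cong (advice []) h++x∷s≡xs))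
        k = length (advice [] h)
        step : Step algorithm tape (h ++ [ x ]) k (chosen d b) (length (spent d b) + k)
        step = subst (λ t → Step algorithm t (h ++ [ x ]) k (chosen d b) (length (spent d b) + k)) tape≡
                     (act-Step d b (advice [] h) _ (algorithm-advice h x))
        labels-∷ʳ : labels (h ++ [ x ]) ≡ labels h ++ [ chosen d b ]
        labels-∷ʳ = trans (cong (map proj₂) (labelling-∷ʳ h x)) (map-++ proj₂ (labelling [] h) _)
        length-advice-∷ʳ : length (advice [] (h ++ [ x ])) ≡ length (spent d b) + k
        length-advice-∷ʳ = begin
          length (advice [] (h ++ [ x ]))        ≡⟨ cong length (advice-++ [] h [ x ]) ⟩
          length (advice [] h ++ spent d b ++ [])  ≡⟨ length-++ (advice [] h) ⟩
          k + length (spent d b ++ [])            ≡⟨ cong (λ l → k + length l) (++-identityʳ (spent d b)) ⟩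
          k + length (spent d b)                  ≡⟨ +-comm k _ ⟩
          length (spent d b) + k                  ∎
          where open ≡-Reasoning

      run : Run algorithm tape xs (labels xs) (length (advice [] xs))
      run = run-prefix (reverseView xs) [] (++-identityʳ xs)

-- The clustering algorithm

sameLabel : Maybe ℕ → Maybe ℕ → Maybe Bool
sameLabel (just a) (just a′) = just (does (a ≟ℕ a′))
sameLabel _        _         = nothing

pairedWith? : Labelling → ℤ → Maybe Bool
pairedWith? st w = sameLabel (lookupLabel w st) (lookupLabel (sucℤ w) st)

inferLeads : Labelling → ℤ → Maybe Bool
inferLeads st x = pairedWith? st (predℤ (predℤ x)) <∣> Maybe.map not (pairedWith? st (sucℤ x))

labelFor : Labelling → ℤ → Bool → ℕ
labelFor st x b = fromMaybe (length st) (lookupLabel (partner b x) st)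

hasSeenNeighbour : Labelling → ℤ → Bool
hasSeenNeighbour st x = is-just (lookupLabel (predℤ x) st) ∨ is-just (lookupLabel (sucℤ x) st)

decide : Labelling → ℤ → Decision
decide st x with lookupLabel x st | inferLeads st x
... | just c  | _       = label c
... | nothing | just b  = label (labelFor st x b)
... | nothing | nothing = if hasSeenNeighbour st x then ask (labelFor st x) else label (length st)

open Replay decide using (algorithm)

sameLabel-just : ∀ {m m′ b} → sameLabel m m′ ≡ just b →
                 ∃[ a ] ∃[ a′ ] m ≡ just a × m′ ≡ just a′ × b ≡ does (a ≟ℕ a′)
sameLabel-just {just a} {just a′} refl = a , a′ , refl , refl , refl

sameLabel-nothingˡ : ∀ {m a} → sameLabel m (just a) ≡ nothing → m ≡ nothing
sameLabel-nothingˡ {nothing} _ = refl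

sameLabel-nothingʳ : ∀ {a m} → sameLabel (just a) m ≡ nothing → m ≡ nothing
sameLabel-nothingʳ {m = nothing} _ = refl

neither-just : ∀ {A : Set} {m m′ : Maybe A} → is-just m ∨ is-just m′ ≡ false → m ≡ nothing × m′ ≡ nothing
neither-just {m = nothing} {nothing} _  = refl , refl
neither-just {m = just _}            ()
neither-just {m = nothing} {just _}  ()

partner-unseen : ∀ {st x} → hasSeenNeighbour st x ≡ false → ∀ b → lookupLabel (partner b x) st ≡ nothing
partner-unseen none-seen true  = proj₂ (neither-just none-seen)
partner-unseen none-seen false = proj₁ (neither-just none-seen)

-- Advice accounting

Isolated : List ℤ → ℤ → Set
Isolated h y = predℤ y ∉ h × sucℤ y ∉ h

isolated? : ∀ h → Decidable (Isolated h)
isolated? h y = ¬? (predℤ y ∈? h) ×-dec ¬? (sucℤ y ∈? h)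

isolatedCount : List ℤ → ℕ
isolatedCount h = count (isolated? h) h

isolated-∷ʳ : ∀ h x y → Isolated (h ++ [ x ]) y → Isolated h y
isolated-∷ʳ _ _ _ (py∉ , sy∉) = py∉ ∘ ∈-++⁺ˡ , sy∉ ∘ ∈-++⁺ˡ

neighbour-∈⇒¬isolated : ∀ {h x y} → Neighbours x y → x ∈ h → ¬ Isolated h y
neighbour-∈⇒¬isolated {h} {x} (inj₁ refl) x∈ (py∉ , _) = py∉ (subst (_∈ h) (sym (ℤₚ.pred-suc x)) x∈)
neighbour-∈⇒¬isolated         (inj₂ refl) x∈ (_ , sy∉) = sy∉ x∈

lonely-neighbour : ∀ {st x} → lookupLabel x st ≡ nothing → inferLeads st x ≡ nothing →
                   hasSeenNeighbour st x ≡ true →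
                   ∃[ y ] Neighbours y x × y ∈ points st × Isolated (points st) y
lonely-neighbour {st} {x} x-new inferred some-seen
  with pairedWith? st (predℤ (predℤ x)) in left | pairedWith? st (sucℤ x) in right | inferred
... | just _  | _       | ()
... | nothing | just _  | ()
... | nothing | nothing | _
  with lookupLabel (predℤ x) st in px-seen | lookupLabel (sucℤ x) st in sx-seen | some-seen
...   | just _  | _       | _  =
  predℤ x , inj₁ (sym (ℤₚ.suc-pred x)) , ∈-map⁺ proj₁ (lookupLabel-just st px-seen) ,
  lookupLabel-nothing st (sameLabel-nothingˡ (trans (cong (sameLabel _) (sym (trans spx-seen px-seen))) left)) ,
  subst (_∉ points st) (sym (ℤₚ.suc-pred x)) (lookupLabel-nothing st x-new)
  where
  spx-seen : lookupLabel (sucℤ (predℤ (predℤ x))) st ≡ lookupLabel (predℤ x) st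
  spx-seen = cong (λ z → lookupLabel z st) (ℤₚ.suc-pred (predℤ x))
...   | nothing | just _  | _  =
  sucℤ x , inj₂ refl , ∈-map⁺ proj₁ (lookupLabel-just st sx-seen) ,
  subst (_∉ points st) (sym (ℤₚ.pred-suc x)) (lookupLabel-nothing st x-new) ,
  lookupLabel-nothing st (sameLabel-nothingʳ right)
...   | nothing | nothing | ()

ask⇒lonely-neighbour : ∀ {st x f} → decide st x ≡ ask f →
                       ∃[ y ] Neighbours y x × y ∈ points st × Isolated (points st) y
ask⇒lonely-neighbour {st} {x} asked with lookupLabel x st in seen | inferLeads st x in inferred | asked
... | just _  | _       | ()
... | nothing | just _  | ()
... | nothing | nothing | asked′ with hasSeenNeighbour st x in some-seen | asked′
...   | false | ()
...   | true  | _ = lonely-neighbour seen inferred some-seen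

isolatedCount-step : ∀ st x b →
  2 * length (spent (decide st x) b) + isolatedCount (points st ++ [ x ]) ≤ isolatedCount (points st) + 1
isolatedCount-step st x b with decide st x in decided
... | label _ = begin
  isolatedCount h′                                     ≡⟨ count-++ (isolated? h′) h [ x ] ⟩
  count (isolated? h′) h + count (isolated? h′) [ x ]  ≤⟨ +-mono-≤ (count-mono (isolated? h′) (isolated? h) (isolated-∷ʳ h x) h)
                                                                    (length-filter (isolated? h′) [ x ]) ⟩
  isolatedCount h + 1                                   ∎
  where
  open ≤-Reasoning
  h = points st
  h′ = h ++ [ x ]
... | ask _ with ask⇒lonely-neighbour decided
...   | y , y~x , y∈h , y-isolated = begin
  2 + isolatedCount h′                                        ≡⟨ cong (_+_ 2) (count-++ (isolated? h′) h [ x ]) ⟩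
  2 + (count (isolated? h′) h + count (isolated? h′) [ x ])   ≡⟨ cong (λ k → 2 + (count (isolated? h′) h + k)) x-paired ⟩
  2 + (count (isolated? h′) h + 0)                            ≡⟨ cong (_+_ 2) (+-identityʳ _) ⟩
  2 + count (isolated? h′) h                                  ≤⟨ s≤s y-paired ⟩
  1 + isolatedCount h                                         ≡⟨ +-comm 1 _ ⟩
  isolatedCount h + 1                                         ∎
  where
  open ≤-Reasoning
  h = points st
  h′ = h ++ [ x ]
  x-paired : count (isolated? h′) [ x ] ≡ 0
  x-paired = cong length (filter-reject (isolated? h′) (neighbour-∈⇒¬isolated y~x (∈-++⁺ˡ y∈h)))
  y-paired : count (isolated? h′) h < isolatedCount h
  y-paired = count-mono-< (isolated? h′) (isolated? h) (isolated-∷ʳ h x) y∈h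
               (neighbour-∈⇒¬isolated (swap y~x) (∈-++⁺ʳ h (here refl))) y-isolated

-- Correctness

module Correctness (xs : List ℤ) where
  open CanonicalPairing xs
  open Replay.WithOracle decide leads public

  Agrees : Labelling → ℤ → ℕ → Set
  Agrees st x c = ∀ {p c′} → (p , c′) ∈ st → (c ≡ c′) ⇔ (leader x ≡ leader p)

  record Coherent (st : Labelling) : Set where
    field
      agrees  : ∀ {p c} → (p , c) ∈ st → Agrees st p c
      bounded : ∀ {p c} → (p , c) ∈ st → c < length st
      inS     : ∀ {p c} → (p , c) ∈ st → p ∈ xs
  open Coherent

  agrees-leader : ∀ {st x y c} → leader x ≡ leader y → Agrees st y c → Agrees st x c
  agrees-leader lx≡ly ag p∈ =
    mk⇔ (trans lx≡ly ∘ Equivalence.to (ag p∈)) (Equivalence.from (ag p∈) ∘ trans (sym lx≡ly))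

  agrees-fresh : ∀ {st x} → Coherent st → lookupLabel x st ≡ nothing → lookupLabel (mate x) st ≡ nothing →
                 Agrees st x (length st)
  agrees-fresh {st} {x} coh x-new mx-new {p} p∈ = mk⇔
    (λ fresh≡c′ → contradiction (bounded coh p∈) (<-irrefl (sym fresh≡c′)))
    (λ lx≡lp → unseen (leader≡⇒≡∨mate (sym lx≡lp)))
    where
    unseen : ∀ {c′} → p ≡ x ⊎ p ≡ mate x → length st ≡ c′
    unseen (inj₁ refl) = contradiction (∈-map⁺ proj₁ p∈) (lookupLabel-nothing st x-new)
    unseen (inj₂ refl) = contradiction (∈-map⁺ proj₁ p∈) (lookupLabel-nothing st mx-new)

  labelFor-agrees : ∀ {st x} → Coherent st → x ∈ xs → lookupLabel x st ≡ nothing →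
                    Agrees st x (labelFor st x (leads x)) × labelFor st x (leads x) ≤ length st
  labelFor-agrees {st} {x} coh x∈ x-new with lookupLabel (partner (leads x) x) st in mx
  ... | nothing = agrees-fresh coh x-new mx , ≤-refl
  ... | just a  = agrees-leader (sym (leader-mate x∈ (inS coh m∈))) (agrees coh m∈) , <⇒≤ (bounded coh m∈)
    where m∈ = lookupLabel-just st mx

  pairedWith?-sound : ∀ {st w b} → Coherent st → pairedWith? st w ≡ just b →
                      w ∈ xs × sucℤ w ∈ xs × b ≡ leads w
  pairedWith?-sound {st} {w} coh eq with sameLabel-just eq
  ... | a , a′ , seen , seen′ , refl =
    inS coh w∈ , inS coh sw∈ ,
    trans (does-⇔ (agrees coh w∈ sw∈) (a ≟ℕ a′) (leader w ℤₚ.≟ leader (sucℤ w)))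
          (does-leader≟leader-suc (inS coh w∈) (inS coh sw∈))
    where
    w∈  = lookupLabel-just st seen
    sw∈ = lookupLabel-just st seen′

  inferLeads-sound : ∀ {st x b} → Coherent st → x ∈ xs → inferLeads st x ≡ just b → b ≡ leads x
  inferLeads-sound {st} {x} coh x∈ eq
    with pairedWith? st (predℤ (predℤ x)) in left | pairedWith? st (sucℤ x) in right | eq
  ... | just b  | _       | refl with pairedWith?-sound coh left
  ...   | ppx∈ , spx∈ , refl = begin
    leads (predℤ (predℤ x))           ≡⟨ not-involutive _ ⟨
    not (not (leads (predℤ (predℤ x)))) ≡⟨ cong not (leads-step px∈ ppx∈) ⟨
    not (leads (predℤ x))             ≡⟨ leads-step x∈ px∈ ⟨
    leads x                           ∎
    where
    open ≡-Reasoning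
    px∈ : predℤ x ∈ xs
    px∈ = subst (_∈ xs) (ℤₚ.suc-pred (predℤ x)) spx∈
  inferLeads-sound {st} {x} coh x∈ eq | nothing | just b′ | refl with pairedWith?-sound coh right
  ... | sx∈ , _ , refl = trans (cong not (leads-suc x∈ sx∈)) (not-involutive (leads x))

  decide-agrees : ∀ {st x} → Coherent st → x ∈ xs →
                  Agrees st x (chosen (decide st x) (leads x)) × chosen (decide st x) (leads x) ≤ length st
  decide-agrees {st} {x} coh x∈ with lookupLabel x st in seen | inferLeads st x in inferred
  ... | just c  | _       = agrees coh c∈ , <⇒≤ (bounded coh c∈)
    where c∈ = lookupLabel-just st seen
  ... | nothing | just b  rewrite inferLeads-sound coh x∈ inferred = labelFor-agrees coh x∈ seen
  ... | nothing | nothing with hasSeenNeighbour st x in neighbours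
  ...   | true  = labelFor-agrees coh x∈ seen
  ...   | false = agrees-fresh coh seen (partner-unseen {st} {x} neighbours (leads x)) , ≤-refl

  coherent-[] : Coherent []
  coherent-[] = record { agrees = λ () ; bounded = λ () ; inS = λ () }

  coherent-∷ʳ : ∀ {st x c} → Coherent st → x ∈ xs → Agrees st x c → c ≤ length st →
                Coherent (st ++ [ (x , c) ])
  coherent-∷ʳ {st} {x} {c} coh x∈ ag c≤ = record { agrees = agrees′ ; bounded = bounded′ ; inS = inS′ }
    where
    st′ = st ++ [ (x , c) ]
    length-st′ : length st′ ≡ suc (length st)
    length-st′ = trans (length-++ st) (+-comm (length st) 1)
    agrees′ : ∀ {p c₀} → (p , c₀) ∈ st′ → Agrees st′ p c₀
    agrees′ p∈ p′∈ with ∈-∷ʳ⁻ p∈ | ∈-∷ʳ⁻ p′∈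
    ... | inj₁ p∈st | inj₁ p′∈st = agrees coh p∈st p′∈st
    ... | inj₁ p∈st | inj₂ refl  = ≡⇔≡-sym (ag p∈st)
    ... | inj₂ refl | inj₁ p′∈st = ag p′∈st
    ... | inj₂ refl | inj₂ refl  = mk⇔ (λ _ → refl) (λ _ → refl)
    bounded′ : ∀ {p c₀} → (p , c₀) ∈ st′ → c₀ < length st′
    bounded′ p∈ with ∈-∷ʳ⁻ p∈
    ... | inj₁ p∈st = subst (_ <_) (sym length-st′) (m≤n⇒m≤1+n (bounded coh p∈st))
    ... | inj₂ refl = subst (_ <_) (sym length-st′) (s≤s c≤)
    inS′ : ∀ {p c₀} → (p , c₀) ∈ st′ → p ∈ xs
    inS′ p∈ with ∈-∷ʳ⁻ p∈
    ... | inj₁ p∈st = inS coh p∈st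
    ... | inj₂ refl = x∈

  coherent : Coherent (labelling [] xs)
  coherent = labelling-preserves Coherent xs
    (λ x∈ coh → coherent-∷ʳ coh x∈ (proj₁ (decide-agrees coh x∈)) (proj₂ (decide-agrees coh x∈)))
    coherent-[]

  final : Labelling
  final = labelling [] xs

  points-final : points final ≡ xs
  points-final = points-labelling [] xs

  zip-final : zip xs (labels xs) ≡ final
  zip-final = subst (λ ps → zip ps (labels xs) ≡ final) points-final (zip-proj₁-proj₂ final)

  valid : ValidClustering xs (labels xs)
  valid x y c x∈ y∈ = leader≡⇒∣i-j∣≤1 (Equivalence.to (agrees coherent (in-final x∈) (in-final y∈)) refl)
    where
    in-final : ∀ {p c} → (p , c) ∈ zip xs (labels xs) → (p , c) ∈ final
    in-final = subst (_ ∈_) zip-final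

  leaders : List ℤ
  leaders = deduplicate ℤₚ._≟_ (filter (λ r → leads r ≟ true) xs)

  ∈-leaders⁻ : ∀ {r} → r ∈ leaders → r ∈ xs × leads r ≡ true
  ∈-leaders⁻ r∈ = ∈-filter⁻ (λ r → leads r ≟ true) (∈-deduplicate⁻ ℤₚ._≟_ _ r∈)

  ∈-leaders⁺ : ∀ {r} → r ∈ xs → leads r ≡ true → r ∈ leaders
  ∈-leaders⁺ r∈ lr = ∈-deduplicate⁺ ℤₚ._≟_ (∈-filter⁺ (λ r → leads r ≟ true) r∈ lr)

  leaders-apart : ∀ {r} → r ∈ leaders → sucℤ r ∉ leaders
  leaders-apart r∈ sr∈ with ∈-leaders⁻ r∈ | ∈-leaders⁻ sr∈
  ... | r∈xs , lr | sr∈xs , lsr = leaders-not-adjacent r∈xs sr∈xs lr lsr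

  cost≤leaders : cost (labels xs) ≤ length leaders
  cost≤leaders = cost-≤ (labelIn final) leaders covered
    where
    covered : ∀ {c} → c ∈ labels xs → c ∈ map (labelIn final) leaders
    covered c∈ with (p , c) , pc∈ , refl ← ∈-map⁻ proj₂ c∈ =
      subst (_∈ map (labelIn final) leaders) same-label
            (∈-map⁺ (labelIn final) (∈-leaders⁺ (leader∈S p∈xs) (leads-leader p∈xs)))
      where
      p∈xs = inS coherent pc∈
      lp∈ : (leader p , labelIn final (leader p)) ∈ final
      lp∈ with _ , lc∈ , refl ← ∈-map⁻ proj₁ (subst (leader p ∈_) (sym points-final) (leader∈S p∈xs)) =
        labelIn-∈ lc∈
      same-label : labelIn final (leader p) ≡ c
      same-label = Equivalence.from (agrees coherent lp∈ pc∈) (leader-leader p∈xs)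

  leaders≤cost : ∀ ds → length ds ≡ length xs → ValidClustering xs ds → length leaders ≤ cost ds
  leaders≤cost ds |ds|≡|xs| valid-ds =
    ≤-cost labelOf (deduplicate-! ℤₚ._≟_ _) injective (∈-zip⁻ʳ xs ds ∘ labelled)
    where
    labelOf = labelIn (zip xs ds)
    labelled : ∀ {r} → r ∈ leaders → (r , labelOf r) ∈ zip xs ds
    labelled r∈ = labelIn-∈ (proj₂ (∈-zip⁺ |ds|≡|xs| (proj₁ (∈-leaders⁻ r∈))))
    injective : ∀ {r r′} → r ∈ leaders → r′ ∈ leaders → labelOf r ≡ labelOf r′ → r ≡ r′
    injective {r} {r′} r∈ r′∈ same
      with ∣i-j∣≤1⇒≡∨neighbours r r′
             (valid-ds r r′ _ (labelled r∈) (subst (λ c → (r′ , c) ∈ zip xs ds) (sym same) (labelled r′∈)))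
    ... | inj₁ r≡r′        = r≡r′
    ... | inj₂ (inj₁ refl) = contradiction r∈ (leaders-apart r′∈)
    ... | inj₂ (inj₂ refl) = contradiction r′∈ (leaders-apart r∈)

  optimal : Optimal xs (labels xs)
  optimal = valid , λ ds |ds|≡|xs| valid-ds → ≤-trans cost≤leaders (leaders≤cost ds |ds|≡|xs| valid-ds)

  advice-bound : length (advice [] xs) ≤ length xs / 2
  advice-bound = k≤n/2 (≤-trans (m≤m+n _ _) (advice-potential isolatedCount step [] xs))
    where step = λ st x → isolatedCount-step st x (leads x)

theorem4 : Σ Algorithm λ A → (xs : List ℤ) → Σ Tape λ t → Σ (List ℕ) λ cs → Σ ℕ λ k →
    Run A t xs cs k × k ≤ length xs / 2 × Optimal xs cs
theorem4 = algorithm , λ xs → let open Correctness xs in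
  tape xs , labels xs , length (advice [] xs) , run xs , advice-bound , optimal
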